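{- Let $G=(V,E)$ be a connected block graph with at least three vertices. Then every minimum restrained dominating set $D$ of $G$ satisfies $|D\cap B|\le 1$ for every block $BC$ of $G$, where $B$ denotes the set of vertices of $BC$ that are not cut vertices of $G$.
   Context: All graphs are finite and simple. A set $D\subseteq V$ is a restrained dominating set of $G=(V,E)$ if every vertex in $V\setminus D$ is adjacent to some vertex in $D$ and to some vertex in $V\setminus D$; it is minimum if it has smallest possible cardinality. A cut vertex of $G$ is a vertex whose removal disconnects $G$. A block is a maximal connected induced subgraph with no cut vertex. A block graph is a graph all of whose blocks are complete graphs. -}

module Defs where

open import Level using (0ℓ)
open import Data.Nat using (ℕ; _≤_)
open import Data.Fin using (Fin)
open import Data.Fin.Subset using (Subset; _∈_; _∉_; _⊆_; _-_; ⊤)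
open import Data.Product using (Σ; _×_; ∃)
open import Relation.Nullary using (¬_)
open import Relation.Binary.PropositionalEquality using (_≡_)

record Graph (n : ℕ) : Set₁ where
  field
    Adj     : Fin n → Fin n → Set
    sym     : ∀ {u v} → Adj u v → Adj v u
    irrefl  : ∀ {u} → ¬ Adj u u

module _ {n : ℕ} (G : Graph n) where
  open Graph G

  data Walk (S : Subset n) : Fin n → Fin n → Set where
    here : ∀ {u} → u ∈ S → Walk S u u
    step : ∀ {u v w} → u ∈ S → Adj u v → Walk S v w → Walk S u w

  ConnectedOn : Subset n → Set
  ConnectedOn S = ∀ u w → u ∈ S → w ∈ S → Walk S u w

  Connected : Set
  Connected = ConnectedOn ⊤

  IsCutVertex : Fin n → Set
  IsCutVertex v = ¬ ConnectedOn (⊤ - v)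

  Nonseparable : Subset n → Set
  Nonseparable S = ConnectedOn S × (∀ v → v ∈ S → ConnectedOn (S - v))

  IsBlock : Subset n → Set
  IsBlock S = Nonseparable S × (∀ T → S ⊆ T → Nonseparable T → T ⊆ S)

  IsBlockGraph : Set
  IsBlockGraph = ∀ S → IsBlock S → ∀ u v → u ∈ S → v ∈ S → ¬ (u ≡ v) → Adj u v

  IsRestrainedDominating : Subset n → Set
  IsRestrainedDominating D =
    ∀ v → v ∉ D → (∃ λ u → u ∈ D × Adj v u) × (∃ λ u → u ∉ D × Adj v u)

  IsMinRestrainedDominating : Subset n → Set
  IsMinRestrainedDominating D =
    IsRestrainedDominating D × (∀ D′ → IsRestrainedDominating D′ → Data.Fin.Subset.∣ D ∣ ≤ Data.Fin.Subset.∣ D′ ∣)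

-- A non-cut vertex v of a block S (with |S| ≥ 2) has all its neighbours in S:
-- otherwise a path from a neighbour w ∉ S back to S avoiding v would be an ear
-- v–w–…–c–b of S, and S together with the ear would be a larger nonseparable
-- set. In a block graph S is complete, so two non-cut vertices u ≠ v of S cannot
-- both lie in a minimum restrained dominating set D. If some z ∈ S is outside D,
-- then D - v is still restrained dominating: v is adjacent to u ∈ D and z ∉ D, and
-- every vertex outside D that v dominated lies in S, hence is adjacent to u. If
-- S ⊆ D, then D - {u, v} is: u and v have no neighbours outside S, they are
-- adjacent to each other, and to a third vertex of S, which exists because G is
-- connected with at least three vertices.
module Submission where

open import Defs
open import Data.Nat using (ℕ; _≤_; s≤s; z≤n)
open import Data.Nat.Properties using (<⇒≱)
open import Data.Fin using (Fin; zero; suc; _≟_)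
open import Data.Fin.Subset using () renaming (⊥ to ∅)
open import Data.Fin.Subset
  using (Subset; _∈_; _∉_; _∩_; _∪_; _-_; _─_; _⊆_; ∣_∣; ⁅_⁆; ⊤; Nonempty; inside; outside)
open import Data.Fin.Subset.Properties
  using ( _∈?_; nonempty?; Empty-unique; ∣⊥∣≡0; ∣⁅x⁆∣≡1; p⊆q⇒∣p∣≤∣q∣; p∩q≢∅⇒∣p─q∣<∣p∣
        ; x∈p∧x∉q⇒x∈p─q; x∈p∧x≢y⇒x∈p-y; p─q⊆p; x∈p∩q⁺; x∈p∩q⁻; x∈p∪q⁺; x∈p∪q⁻
        ; p⊆p∪q; q⊆p∪q; x∈⁅x⁆; x∈⁅y⁆⇒x≡y; ∈⊤; ∉⊥)
open import Data.List using (List; []; _∷_)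
open import Data.List.Membership.Propositional using () renaming (_∈_ to _∈ᴸ_)
open import Data.List.Relation.Binary.Subset.Propositional using () renaming (_⊆_ to _⊆ᴸ_)
open import Data.List.Relation.Unary.Any using (here; there)
import Data.List.Relation.Unary.All as All
open import Data.List.Relation.Unary.All.Properties using (¬Any⇒All¬; anti-mono)
open import Data.List.Relation.Unary.Unique.Propositional using (Unique)
open import Data.List.Relation.Unary.AllPairs using ([]; _∷_)
import Data.Vec.Base as Vec
open import Data.Product using (_×_; _,_; proj₁; proj₂; ∃; ∃₂)
open import Data.Sum using (_⊎_; inj₁; inj₂; [_,_]′)
open import Data.Empty using (⊥; ⊥-elim)
open import Function using (_∘_)
open import Function.Bundles using (_⇔_; Equivalence)
open import Relation.Nullary using (¬_; yes; no)
open import Relation.Binary.PropositionalEquality using (_≡_; _≢_; refl; sym; subst)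

private
  variable
    n : ℕ

x∈p─q⇒x∉q : ∀ {x : Fin n} (p q : Subset n) → x ∈ p ─ q → x ∉ q
x∈p─q⇒x∉q {x = zero}  (_ Vec.∷ p) (outside Vec.∷ q) _ ()
x∈p─q⇒x∉q {x = zero}  (_ Vec.∷ p) (inside  Vec.∷ q) ()
x∈p─q⇒x∉q {x = suc x} (_ Vec.∷ p) (_ Vec.∷ q) (Vec.there x∈p─q) (Vec.there x∈q) =
  x∈p─q⇒x∉q p q x∈p─q x∈q

x∈p-y⇒x≢y : ∀ {x y : Fin n} {p : Subset n} → x ∈ p - y → x ≢ y
x∈p-y⇒x≢y {y = y} {p} x∈p-y refl = x∈p─q⇒x∉q p ⁅ y ⁆ x∈p-y (x∈⁅x⁆ y)

x∈p-y⇒x∈p : ∀ {x y : Fin n} {p : Subset n} → x ∈ p - y → x ∈ p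
x∈p-y⇒x∈p {y = y} {p} = p─q⊆p p ⁅ y ⁆

x∈⁅y⁆∪⁅z⁆⁻ : ∀ {x y z : Fin n} → x ∈ ⁅ y ⁆ ∪ ⁅ z ⁆ → x ≡ y ⊎ x ≡ z
x∈⁅y⁆∪⁅z⁆⁻ {x = x} {y} {z} x∈ with x∈p∪q⁻ ⁅ y ⁆ ⁅ z ⁆ x∈
... | inj₁ x∈⁅y⁆ = inj₁ (x∈⁅y⁆⇒x≡y y x∈⁅y⁆)
... | inj₂ x∈⁅z⁆ = inj₂ (x∈⁅y⁆⇒x≡y z x∈⁅z⁆)

∣p∣≤1 : (p : Subset n) → (∀ {x y} → x ∈ p → y ∈ p → x ≡ y) → ∣ p ∣ ≤ 1
∣p∣≤1 {n} p unique with nonempty? p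
... | no ¬nonempty =
  subst (λ q → ∣ q ∣ ≤ 1) (sym (Empty-unique ¬nonempty)) (subst (_≤ 1) (sym (∣⊥∣≡0 n)) z≤n)
... | yes (x , x∈p) = subst (∣ p ∣ ≤_) (∣⁅x⁆∣≡1 x) (p⊆q⇒∣p∣≤∣q∣ p⊆⁅x⁆)
  where
  p⊆⁅x⁆ : p ⊆ ⁅ x ⁆
  p⊆⁅x⁆ y∈p = subst (_∈ ⁅ x ⁆) (unique x∈p y∈p) (x∈⁅x⁆ x)

fromList : List (Fin n) → Subset n
fromList []       = ∅
fromList (x ∷ xs) = ⁅ x ⁆ ∪ fromList xs

∈-fromList⁺ : ∀ {x : Fin n} {xs} → x ∈ᴸ xs → x ∈ fromList xs
∈-fromList⁺ {x = x} {_ ∷ xs} (here refl) = x∈p∪q⁺ (inj₁ (x∈⁅x⁆ x))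
∈-fromList⁺ {xs = y ∷ xs} (there x∈xs) = x∈p∪q⁺ (inj₂ (∈-fromList⁺ x∈xs))

∈-fromList⁻ : ∀ {x : Fin n} {xs} → x ∈ fromList xs → x ∈ᴸ xs
∈-fromList⁻ {xs = []} x∈ = ⊥-elim (∉⊥ x∈)
∈-fromList⁻ {xs = y ∷ xs} x∈ with x∈p∪q⁻ ⁅ y ⁆ (fromList xs) x∈
... | inj₁ x∈⁅y⁆ = here (x∈⁅y⁆⇒x≡y y x∈⁅y⁆)
... | inj₂ x∈xs = there (∈-fromList⁻ x∈xs)

third-vertex : 3 ≤ n → (u v : Fin n) → ∃ λ t → t ≢ u × t ≢ v
third-vertex (s≤s (s≤s (s≤s _))) zero zero = suc zero , (λ ()) , (λ ())
third-vertex (s≤s (s≤s (s≤s _))) zero (suc zero) = suc (suc zero) , (λ ()) , (λ ())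
third-vertex (s≤s (s≤s (s≤s _))) zero (suc (suc _)) = suc zero , (λ ()) , (λ ())
third-vertex (s≤s (s≤s (s≤s _))) (suc zero) zero = suc (suc zero) , (λ ()) , (λ ())
third-vertex (s≤s (s≤s (s≤s _))) (suc zero) (suc _) = zero , (λ ()) , (λ ())
third-vertex (s≤s (s≤s (s≤s _))) (suc (suc _)) zero = suc zero , (λ ()) , (λ ())
third-vertex (s≤s (s≤s (s≤s _))) (suc (suc _)) (suc _) = zero , (λ ()) , (λ ())

module Walks (G : Graph n) where
  open Graph G renaming (sym to adj-sym)
  open import Data.List.Membership.DecPropositional (_≟_ {n}) using () renaming (_∈?_ to _∈ᴸ?_)

  private
    variable
      S T Q : Subset n
      a b c u v w x y : Fin n
      xs : List (Fin n)

  walk-start∈ : Walk G S u w → u ∈ S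
  walk-start∈ (here u∈S)     = u∈S
  walk-start∈ (step u∈S _ _) = u∈S

  walk-end∈ : Walk G S u w → w ∈ S
  walk-end∈ (here w∈S)   = w∈S
  walk-end∈ (step _ _ r) = walk-end∈ r

  walk-mono : S ⊆ T → Walk G S u w → Walk G T u w
  walk-mono S⊆T (here u∈S)     = here (S⊆T u∈S)
  walk-mono S⊆T (step u∈S e r) = step (S⊆T u∈S) e (walk-mono S⊆T r)

  _++ʷ_ : Walk G S u v → Walk G S v w → Walk G S u w
  here _       ++ʷ r′ = r′
  step u∈S e r ++ʷ r′ = step u∈S e (r ++ʷ r′)

  walk-snoc : Walk G S u v → Adj v w → w ∈ S → Walk G S u w
  walk-snoc r e w∈S = r ++ʷ step (walk-end∈ r) e (here w∈S)

  walk-reverse : Walk G S u w → Walk G S w u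
  walk-reverse (here u∈S)     = here u∈S
  walk-reverse (step u∈S e r) = walk-snoc (walk-reverse r) (adj-sym e) u∈S

  connectedOn-hub : ∀ r → (∀ y → y ∈ S → Walk G S y r) → ConnectedOn G S
  connectedOn-hub r to-r u w u∈S w∈S = to-r u u∈S ++ʷ walk-reverse (to-r w w∈S)

  data Path : Fin n → Fin n → List (Fin n) → Set where
    [_]  : ∀ a → Path a a (a ∷ [])
    _∷ᵖ_ : ∀ {a p b xs} → Adj a p → Path p b xs → Path a b (a ∷ xs)

  infixr 5 _∷ᵖ_

  path-start∈ : Path a b xs → a ∈ᴸ xs
  path-start∈ [ a ]    = here refl
  path-start∈ (_ ∷ᵖ _) = here refl

  path-walk : (∀ {z} → z ∈ᴸ xs → z ∈ Q) → Path a b xs → Walk G Q a b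
  path-walk xs⊆Q [ a ]    = here (xs⊆Q (here refl))
  path-walk xs⊆Q (e ∷ᵖ P) = step (xs⊆Q (here refl)) e (path-walk (xs⊆Q ∘ there) P)

  path-walk-to : (∀ {z} → z ∈ᴸ xs → z ∈ Q) → Path a b xs → y ∈ᴸ xs → Walk G Q a y
  path-walk-to xs⊆Q [ a ]    (here refl)  = here (xs⊆Q (here refl))
  path-walk-to xs⊆Q (_ ∷ᵖ _) (here refl)  = here (xs⊆Q (here refl))
  path-walk-to xs⊆Q (e ∷ᵖ P) (there y∈xs) =
    step (xs⊆Q (here refl)) e (path-walk-to (xs⊆Q ∘ there) P y∈xs)

  path-walk-from : (∀ {z} → z ∈ᴸ xs → z ∈ Q) → Path a b xs → y ∈ᴸ xs → Walk G Q y b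
  path-walk-from xs⊆Q [ a ]    (here refl)  = path-walk xs⊆Q [ a ]
  path-walk-from xs⊆Q (e ∷ᵖ P) (here refl)  = path-walk xs⊆Q (e ∷ᵖ P)
  path-walk-from xs⊆Q (e ∷ᵖ P) (there y∈xs) = path-walk-from (xs⊆Q ∘ there) P y∈xs

  path-suffix : Unique xs → Path a b xs → y ∈ᴸ xs →
                ∃ λ ys → Path y b ys × Unique ys × ys ⊆ᴸ xs
  path-suffix uniq [ a ]    (here refl) = _ , [ a ] , uniq , (λ z∈ → z∈)
  path-suffix uniq (e ∷ᵖ P) (here refl) = _ , e ∷ᵖ P , uniq , (λ z∈ → z∈)
  path-suffix (_ ∷ uniq) (_ ∷ᵖ P) (there y∈xs) with path-suffix uniq P y∈xs
  ... | ys , P′ , uniq′ , ys⊆xs = ys , P′ , uniq′ , there ∘ ys⊆xs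

  path-erase-loops : Path a b xs → ∃ λ ys → Path a b ys × Unique ys × ys ⊆ᴸ xs
  path-erase-loops [ a ] = _ , [ a ] , All.[] ∷ [] , (λ z∈ → z∈)
  path-erase-loops {a} (e ∷ᵖ P) with path-erase-loops P
  ... | ys , P′ , uniq , ys⊆xs with a ∈ᴸ? ys
  ...   | yes a∈ys = let zs , P″ , uniq′ , zs⊆ys = path-suffix uniq P′ a∈ys
                     in zs , P″ , uniq′ , there ∘ ys⊆xs ∘ zs⊆ys
  ...   | no  a∉ys = a ∷ ys , e ∷ᵖ P′ , ¬Any⇒All¬ ys a∉ys ∷ uniq ,
                     λ { (here refl) → here refl ; (there z∈ys) → there (ys⊆xs z∈ys) }

  -- Simplicity is essential: on a walk visiting x twice, the vertices between the
  -- two visits may reach neither end once x is removed.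
  path-detour : Unique xs → Path a c xs → (∀ {z} → z ∈ᴸ xs → z ≢ x → z ∈ Q) →
                y ∈ᴸ xs → y ≢ x → Walk G Q y a ⊎ Walk G Q y c
  path-detour _ [ a ]    xs-x⊆Q (here refl) y≢x = inj₁ (here (xs-x⊆Q (here refl) y≢x))
  path-detour _ (_ ∷ᵖ _) xs-x⊆Q (here refl) y≢x = inj₁ (here (xs-x⊆Q (here refl) y≢x))
  path-detour {x = x} (a∉xs ∷ uniq) (_∷ᵖ_ {a} e P) xs-x⊆Q (there y∈xs) y≢x with a ≟ x
  ... | yes refl = inj₂ (path-walk-from tail⊆Q P y∈xs)
    where
    tail⊆Q : ∀ {z} → z ∈ᴸ _ → z ∈ _
    tail⊆Q z∈xs = xs-x⊆Q (there z∈xs) (λ z≡a → All.lookup a∉xs z∈xs (sym z≡a))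
  ... | no a≢x with path-detour uniq P (λ z∈xs → xs-x⊆Q (there z∈xs)) y∈xs y≢x
  ...   | inj₁ y⇝p = inj₁ (walk-snoc y⇝p (adj-sym e) (xs-x⊆Q (here refl) a≢x))
  ...   | inj₂ y⇝c = inj₂ y⇝c

  walk-exit : Walk G (⊤ - v) w u → w ∉ S → u ∈ S →
              ∃₂ λ c b → ∃ λ xs → Path w c xs × All.All (_∉ S) xs × Adj c b × b ∈ S × b ≢ v
  walk-exit (here _) w∉S w∈S = ⊥-elim (w∉S w∈S)
  walk-exit {S = S} (step {v = p} _ e r) w∉S u∈S with p ∈? S
  ... | yes p∈S = _ , p , _ , [ _ ] , w∉S All.∷ All.[] , e , p∈S , x∈p-y⇒x≢y (walk-start∈ r)
  ... | no  p∉S with walk-exit r p∉S u∈S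
  ...   | c , b , xs , P , xs∉S , e′ , b∈S , b≢v =
          c , b , _ , e ∷ᵖ P , w∉S All.∷ xs∉S , e′ , b∈S , b≢v

  module Ear (S-ns : Nonseparable G S) {v b w c xs}
             (v∈S : v ∈ S) (b∈S : b ∈ S) (b≢v : b ≢ v) (e₀ : Adj v w) (P : Path w c xs)
             (e₁ : Adj c b) (xs∉S : All.All (_∉ S) xs) (uniq : Unique xs) where

    ear : Subset n
    ear = S ∪ fromList xs

    S⊆ear : S ⊆ ear
    S⊆ear = p⊆p∪q (fromList xs)

    xs⊆ear : ∀ {z} → z ∈ᴸ xs → z ∈ ear
    xs⊆ear = q⊆p∪q S (fromList xs) ∘ ∈-fromList⁺

    ear⁻ : ∀ {z} → z ∈ ear → z ∈ S ⊎ z ∈ᴸ xs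
    ear⁻ z∈ear with x∈p∪q⁻ S (fromList xs) z∈ear
    ... | inj₁ z∈S  = inj₁ z∈S
    ... | inj₂ z∈xs = inj₂ (∈-fromList⁻ z∈xs)

    S-connected : ConnectedOn G S
    S-connected = proj₁ S-ns

    S-separable : ∀ x → x ∈ S → ConnectedOn G (S - x)
    S-separable = proj₂ S-ns

    S-x⊆ear-x : S - x ⊆ ear - x
    S-x⊆ear-x z∈S-x = x∈p∧x≢y⇒x∈p-y (S⊆ear (x∈p-y⇒x∈p z∈S-x)) (x∈p-y⇒x≢y z∈S-x)

    S⊆ear-x : x ∉ S → S ⊆ ear - x
    S⊆ear-x x∉S z∈S = x∈p∧x≢y⇒x∈p-y (S⊆ear z∈S) (λ { refl → x∉S z∈S })

    xs⊆ear-x : x ∈ S → ∀ {z} → z ∈ᴸ xs → z ∈ ear - x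
    xs⊆ear-x x∈S z∈xs = x∈p∧x≢y⇒x∈p-y (xs⊆ear z∈xs) (λ { refl → All.lookup xs∉S z∈xs x∈S })

    walk-to-v : (∀ {z} → z ∈ᴸ xs → z ∈ Q) → v ∈ Q → y ∈ᴸ xs → Walk G Q y v
    walk-to-v xs⊆Q v∈Q y∈xs =
      walk-snoc (walk-reverse (path-walk-to xs⊆Q P y∈xs)) (adj-sym e₀) v∈Q

    walk-to-b : (∀ {z} → z ∈ᴸ xs → z ∈ Q) → b ∈ Q → y ∈ᴸ xs → Walk G Q y b
    walk-to-b xs⊆Q b∈Q y∈xs = walk-snoc (path-walk-from xs⊆Q P y∈xs) e₁ b∈Q

    ear-connected : ConnectedOn G ear
    ear-connected = connectedOn-hub v to-v
      where
      to-v : ∀ y → y ∈ ear → Walk G ear y v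
      to-v y y∈ear with ear⁻ y∈ear
      ... | inj₁ y∈S  = walk-mono S⊆ear (S-connected y v y∈S v∈S)
      ... | inj₂ y∈xs = walk-to-v xs⊆ear (S⊆ear v∈S) y∈xs

    ear-minus-S-vertex : x ∈ S → ConnectedOn G (ear - x)
    ear-minus-S-vertex {x} x∈S with x ≟ v
    ... | yes refl = connectedOn-hub b to-b
      where
      to-b : ∀ y → y ∈ ear - x → Walk G (ear - x) y b
      to-b y y∈ with ear⁻ (x∈p-y⇒x∈p y∈)
      ... | inj₁ y∈S  = walk-mono S-x⊆ear-x (S-separable x x∈S y b
                          (x∈p∧x≢y⇒x∈p-y y∈S (x∈p-y⇒x≢y y∈)) (x∈p∧x≢y⇒x∈p-y b∈S b≢v))
      ... | inj₂ y∈xs = walk-to-b (xs⊆ear-x x∈S) (x∈p∧x≢y⇒x∈p-y (S⊆ear b∈S) b≢v) y∈xs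
    ... | no x≢v = connectedOn-hub v to-v
      where
      to-v : ∀ y → y ∈ ear - x → Walk G (ear - x) y v
      to-v y y∈ with ear⁻ (x∈p-y⇒x∈p y∈)
      ... | inj₁ y∈S  = walk-mono S-x⊆ear-x (S-separable x x∈S y v
                          (x∈p∧x≢y⇒x∈p-y y∈S (x∈p-y⇒x≢y y∈)) (x∈p∧x≢y⇒x∈p-y v∈S (x≢v ∘ sym)))
      ... | inj₂ y∈xs = walk-to-v (xs⊆ear-x x∈S) (x∈p∧x≢y⇒x∈p-y (S⊆ear v∈S) (x≢v ∘ sym)) y∈xs

    ear-minus-path-vertex : x ∉ S → ConnectedOn G (ear - x)
    ear-minus-path-vertex {x} x∉S = connectedOn-hub v to-v
      where
      to-v : ∀ y → y ∈ ear - x → Walk G (ear - x) y v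
      to-v y y∈ with ear⁻ (x∈p-y⇒x∈p y∈)
      ... | inj₁ y∈S  = walk-mono (S⊆ear-x x∉S) (S-connected y v y∈S v∈S)
      ... | inj₂ y∈xs with path-detour uniq P (x∈p∧x≢y⇒x∈p-y ∘ xs⊆ear) y∈xs (x∈p-y⇒x≢y y∈)
      ...   | inj₁ y⇝w = walk-snoc y⇝w (adj-sym e₀) (S⊆ear-x x∉S v∈S)
      ...   | inj₂ y⇝c = walk-snoc y⇝c e₁ (S⊆ear-x x∉S b∈S)
                         ++ʷ walk-mono (S⊆ear-x x∉S) (S-connected b v b∈S v∈S)

    ear-nonseparable : Nonseparable G ear
    ear-nonseparable = ear-connected , minus
      where
      minus : ∀ x → x ∈ ear → ConnectedOn G (ear - x)
      minus x _ with x ∈? S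
      ... | yes x∈S = ear-minus-S-vertex x∈S
      ... | no  x∉S = ear-minus-path-vertex x∉S

  neighbour∈block : IsBlock G S → u ∈ S → v ∈ S → u ≢ v →
                    ConnectedOn G (⊤ - v) → Adj v w → w ∈ S
  neighbour∈block {S} {u} {v} {w} (S-ns , S-maximal) u∈S v∈S u≢v G-v-connected e with w ∈? S
  ... | yes w∈S = w∈S
  ... | no  w∉S with walk-exit (G-v-connected w u w∈⊤-v u∈⊤-v) w∉S u∈S
    where
    w∈⊤-v : w ∈ ⊤ - v
    w∈⊤-v = x∈p∧x≢y⇒x∈p-y ∈⊤ λ { refl → irrefl e }
    u∈⊤-v : u ∈ ⊤ - v
    u∈⊤-v = x∈p∧x≢y⇒x∈p-y ∈⊤ u≢v
  ... | c , b , xs , P , xs∉S , e₁ , b∈S , b≢v with path-erase-loops P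
  ... | ys , P′ , uniq , ys⊆xs =
    ⊥-elim (w∉S (S-maximal ear S⊆ear ear-nonseparable (xs⊆ear (path-start∈ P′))))
    where open Ear S-ns v∈S b∈S b≢v e P′ e₁ (anti-mono ys⊆xs xs∉S) uniq

  outer-neighbour : 3 ≤ n → Connected G → ∀ u v → ∃ λ y → y ≢ u × y ≢ v × (Adj y u ⊎ Adj y v)
  outer-neighbour 3≤n G-connected u v =
    let t , t≢u , t≢v = third-vertex 3≤n u v in approach (G-connected t u ∈⊤ ∈⊤) t≢u t≢v
    where
    approach : ∀ {t} → Walk G ⊤ t u → t ≢ u → t ≢ v → ∃ λ y → y ≢ u × y ≢ v × (Adj y u ⊎ Adj y v)
    approach (here _) t≢u _ = ⊥-elim (t≢u refl)
    approach {t} (step {v = p} _ e r) t≢u t≢v with p ≟ u | p ≟ v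
    ... | yes refl | _        = t , t≢u , t≢v , inj₁ e
    ... | no _     | yes refl = t , t≢u , t≢v , inj₂ e
    ... | no p≢u   | no p≢v   = approach r p≢u p≢v

module RestrainedDomination (G : Graph n) where
  open Graph G

  private
    variable
      D R : Subset n

  restrained-─ : IsRestrainedDominating G D →
    (∀ {r} → r ∈ D → r ∈ R → (∃ λ d → d ∈ D ─ R × Adj r d) × (∃ λ z → z ∉ D ─ R × Adj r z)) →
    (∀ {y r} → y ∉ D → r ∈ D → r ∈ R → Adj y r → ∃ λ d → d ∈ D ─ R × Adj y d) →
    IsRestrainedDominating G (D ─ R)
  restrained-─ {D} {R} D-rd removed reroute y y∉D─R with y ∈? D | y ∈? R
  ... | yes y∈D | yes y∈R = removed y∈D y∈R
  ... | yes y∈D | no  y∉R = ⊥-elim (y∉D─R (x∈p∧x∉q⇒x∈p─q y∈D y∉R))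
  ... | no  y∉D | _       = dominator (proj₁ (D-rd y y∉D)) , outsider (proj₂ (D-rd y y∉D))
    where
    dominator : (∃ λ d → d ∈ D × Adj y d) → ∃ λ d → d ∈ D ─ R × Adj y d
    dominator (d , d∈D , e) with d ∈? R
    ... | yes d∈R = reroute y∉D d∈D d∈R e
    ... | no  d∉R = d , x∈p∧x∉q⇒x∈p─q d∈D d∉R , e
    outsider : (∃ λ z → z ∉ D × Adj y z) → ∃ λ z → z ∉ D ─ R × Adj y z
    outsider (z , z∉D , e) = z , z∉D ∘ p─q⊆p D R , e

  minimum⇒¬restrained-─ : IsMinRestrainedDominating G D → Nonempty (D ∩ R) →
                          ¬ IsRestrainedDominating G (D ─ R)
  minimum⇒¬restrained-─ {D} {R} (_ , minimum) D∩R≢∅ D─R-rd =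
    <⇒≱ (p∩q≢∅⇒∣p─q∣<∣p∣ D R D∩R≢∅) (minimum (D ─ R) D─R-rd)

module NonCutPair {G : Graph n} (G-block : IsBlockGraph G) {S : Subset n} (S-block : IsBlock G S)
  {u v : Fin n} (u∈S : u ∈ S) (v∈S : v ∈ S) (u≢v : u ≢ v)
  (G-u-connected : ConnectedOn G (⊤ - u)) (G-v-connected : ConnectedOn G (⊤ - v)) where
  open Graph G renaming (sym to adj-sym)
  open Walks G
  open RestrainedDomination G

  private
    variable
      D : Subset n
      x y z : Fin n

  N[u]⊆S : Adj u x → x ∈ S
  N[u]⊆S = neighbour∈block S-block v∈S u∈S (u≢v ∘ sym) G-u-connected

  N[v]⊆S : Adj v x → x ∈ S
  N[v]⊆S = neighbour∈block S-block u∈S v∈S u≢v G-v-connected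

  S-complete : x ∈ S → y ∈ S → x ≢ y → Adj x y
  S-complete = G-block S S-block _ _

  drop-v-restrained : IsRestrainedDominating G D → u ∈ D → z ∈ S → z ∉ D →
                      IsRestrainedDominating G (D - v)
  drop-v-restrained {D} {z} D-rd u∈D z∈S z∉D = restrained-─ D-rd removed reroute
    where
    u∈D-v : u ∈ D - v
    u∈D-v = x∈p∧x≢y⇒x∈p-y u∈D u≢v
    removed : ∀ {r} → r ∈ D → r ∈ ⁅ v ⁆ →
              (∃ λ d → d ∈ D - v × Adj r d) × (∃ λ z → z ∉ D - v × Adj r z)
    removed v∈D r∈⁅v⁆ with x∈⁅y⁆⇒x≡y v r∈⁅v⁆
    ... | refl = (u , u∈D-v , S-complete v∈S u∈S (u≢v ∘ sym))
               , (z , z∉D ∘ x∈p-y⇒x∈p , S-complete v∈S z∈S λ { refl → z∉D v∈D })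
    reroute : ∀ {y r} → y ∉ D → r ∈ D → r ∈ ⁅ v ⁆ → Adj y r → ∃ λ d → d ∈ D - v × Adj y d
    reroute y∉D _ r∈⁅v⁆ e with x∈⁅y⁆⇒x≡y v r∈⁅v⁆
    ... | refl = u , u∈D-v , S-complete (N[v]⊆S (adj-sym e)) u∈S λ { refl → y∉D u∈D }

  drop-pair-restrained : IsRestrainedDominating G D → S ⊆ D → z ∈ S → z ≢ u → z ≢ v →
                         IsRestrainedDominating G (D ─ (⁅ u ⁆ ∪ ⁅ v ⁆))
  drop-pair-restrained {D} {z} D-rd S⊆D z∈S z≢u z≢v = restrained-─ D-rd removed reroute
    where
    R : Subset n
    R = ⁅ u ⁆ ∪ ⁅ v ⁆
    z∈D─R : z ∈ D ─ R
    z∈D─R = x∈p∧x∉q⇒x∈p─q (S⊆D z∈S) λ z∈R → [ z≢u , z≢v ]′ (x∈⁅y⁆∪⁅z⁆⁻ z∈R)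
    R∉D─R : ∀ {r} → r ∈ R → r ∉ D ─ R
    R∉D─R r∈R r∈D─R = x∈p─q⇒x∉q D R r∈D─R r∈R
    removed : ∀ {r} → r ∈ D → r ∈ R → (∃ λ d → d ∈ D ─ R × Adj r d) × (∃ λ z → z ∉ D ─ R × Adj r z)
    removed _ r∈R with x∈⁅y⁆∪⁅z⁆⁻ r∈R
    ... | inj₁ refl = (z , z∈D─R , S-complete u∈S z∈S (z≢u ∘ sym))
                    , (v , R∉D─R (x∈p∪q⁺ (inj₂ (x∈⁅x⁆ v))) , S-complete u∈S v∈S u≢v)
    ... | inj₂ refl = (z , z∈D─R , S-complete v∈S z∈S (z≢v ∘ sym))
                    , (u , R∉D─R (x∈p∪q⁺ (inj₁ (x∈⁅x⁆ u))) , S-complete v∈S u∈S (u≢v ∘ sym))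
    reroute : ∀ {y r} → y ∉ D → r ∈ D → r ∈ R → Adj y r → ∃ λ d → d ∈ D ─ R × Adj y d
    reroute y∉D _ r∈R e with x∈⁅y⁆∪⁅z⁆⁻ r∈R
    ... | inj₁ refl = ⊥-elim (y∉D (S⊆D (N[u]⊆S (adj-sym e))))
    ... | inj₂ refl = ⊥-elim (y∉D (S⊆D (N[v]⊆S (adj-sym e))))

  noncut-pair⊈minimum : 3 ≤ n → Connected G → IsMinRestrainedDominating G D → u ∈ D → v ∈ D → ⊥
  noncut-pair⊈minimum {D} 3≤n G-connected D-min u∈D v∈D with nonempty? (S ─ D)
  ... | yes (z , z∈S─D) =
    minimum⇒¬restrained-─ D-min (v , x∈p∩q⁺ (v∈D , x∈⁅x⁆ v))
      (drop-v-restrained (proj₁ D-min) u∈D (p─q⊆p S D z∈S─D) (x∈p─q⇒x∉q S D z∈S─D))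
  ... | no S─D-empty =
    let z , z≢u , z≢v , adjacent = outer-neighbour 3≤n G-connected u v
        z∈S = [ N[u]⊆S ∘ adj-sym , N[v]⊆S ∘ adj-sym ]′ adjacent
    in minimum⇒¬restrained-─ D-min (u , x∈p∩q⁺ (u∈D , x∈p∪q⁺ (inj₁ (x∈⁅x⁆ u))))
         (drop-pair-restrained (proj₁ D-min) S⊆D z∈S z≢u z≢v)
    where
    S⊆D : S ⊆ D
    S⊆D {x} x∈S with x ∈? D
    ... | yes x∈D = x∈D
    ... | no  x∉D = ⊥-elim (S─D-empty (x , x∈p∧x∉q⇒x∈p─q x∈S x∉D))

lemma5p1 : ∀ (n : ℕ) (G : Graph n) → 3 ≤ n → Connected G → IsBlockGraph G →
    ∀ (D : Subset n) → IsMinRestrainedDominating G D →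
    ∀ (S : Subset n) → IsBlock G S →
    ∀ (B : Subset n) → (∀ v → (v ∈ B) ⇔ (v ∈ S × ¬ IsCutVertex G v)) →
    ∣ D ∩ B ∣ ≤ 1
lemma5p1 n G 3≤n G-connected G-block D D-min S S-block B B-spec = ∣p∣≤1 (D ∩ B) D∩B-unique
  where
  D∩B-unique : ∀ {x y} → x ∈ D ∩ B → y ∈ D ∩ B → x ≡ y
  D∩B-unique {x} {y} x∈D∩B y∈D∩B with x ≟ y
  ... | yes x≡y = x≡y
  ... | no  x≢y =
    let x∈D , x∈B = x∈p∩q⁻ D B x∈D∩B
        y∈D , y∈B = x∈p∩q⁻ D B y∈D∩B
        x∈S , x-noncut = Equivalence.to (B-spec x) x∈B
        y∈S , y-noncut = Equivalence.to (B-spec y) y∈B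
    in ⊥-elim (x-noncut λ G-x-connected → y-noncut λ G-y-connected →
         NonCutPair.noncut-pair⊈minimum G-block S-block x∈S y∈S x≢y G-x-connected G-y-connected
           3≤n G-connected D-min x∈D y∈D)
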